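{- There are no $2$-dimensional $\mathbb{F}_q$-linear complete symmetric rank-distance (CSRD) codes in $M_{3\times3}(\mathbb{F}_q)$ of minimum distance $2$.
   Context: An $\mathbb{F}_q$-linear symmetric rank-distance (SRD) code is an $\mathbb{F}_q$-subspace $C$ (with $|C|\ge2$) of the space $\mathrm{Sym}_3(\mathbb{F}_q)$ of symmetric $3\times3$ matrices over $\mathbb{F}_q$; its minimum distance is the minimum rank of its nonzero elements. Such a code of minimum distance $d$ is complete if it is not contained in a strictly larger $\mathbb{F}_q$-linear SRD code in $\mathrm{Sym}_3(\mathbb{F}_q)$ of minimum distance $d$. -}

module Defs where

open import Level using (Level; _⊔_) renaming (suc to lsuc)
open import Algebra.Bundles using (CommutativeRing)
open import Data.Fin using (Fin; zero; suc)
open import Data.List using (List)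
open import Data.List.Relation.Unary.Any using (Any)
open import Data.Product using (Σ; ∃; ∃-syntax; _×_; _,_)
open import Relation.Nullary using (¬_)

record Field (c ℓ : Level) : Set (lsuc (c ⊔ ℓ)) where
  field
    commutativeRing : CommutativeRing c ℓ
  open CommutativeRing commutativeRing public
  field
    0≉1     : ¬ (0# ≈ 1#)
    inverse : ∀ x → ¬ (x ≈ 0#) → ∃[ y ] (x * y ≈ 1#)

IsFinite : ∀ {c ℓ} → Field c ℓ → Set (c ⊔ ℓ)
IsFinite F = ∃[ xs ] (∀ x → Any (x ≈_) xs)
  where open Field F

module Matrices {c ℓ} (F : Field c ℓ) where
  open Field F using (Carrier; _≈_; _+_; _*_; _-_; 0#; 1#)

  Mat : Set c
  Mat = Fin 3 → Fin 3 → Carrier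

  _≈ₘ_ : Mat → Mat → Set ℓ
  A ≈ₘ B = ∀ i j → A i j ≈ B i j

  0ₘ : Mat
  0ₘ i j = 0#

  _+ₘ_ : Mat → Mat → Mat
  (A +ₘ B) i j = A i j + B i j

  _·ₘ_ : Carrier → Mat → Mat
  (a ·ₘ A) i j = a * A i j

  Symmetric : Mat → Set ℓ
  Symmetric A = ∀ i j → A i j ≈ A j i

  minor2 : Mat → Fin 3 → Fin 3 → Fin 3 → Fin 3 → Carrier
  minor2 A i j k l = A i k * A j l - A i l * A j k

  det : Mat → Carrier
  det A = A zero zero * minor2 A (suc zero) (suc (suc zero)) (suc zero) (suc (suc zero))
        - A zero (suc zero) * minor2 A (suc zero) (suc (suc zero)) zero (suc (suc zero))
        + A zero (suc (suc zero)) * minor2 A (suc zero) (suc (suc zero)) zero (suc zero)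

  -- (determinantal) rank: rank A ≥ r iff some r×r minor of A is nonzero
  RankAtLeast : Mat → Fin 4 → Set (c ⊔ ℓ)
  RankAtLeast A zero = Level.Lift (c ⊔ ℓ) Data.Unit.⊤
    where import Data.Unit
  RankAtLeast A (suc zero) = Level.Lift c (∃[ i ] ∃[ j ] (¬ (A i j ≈ 0#)))
  RankAtLeast A (suc (suc zero)) =
    Level.Lift c (∃[ i ] ∃[ j ] ∃[ k ] ∃[ l ] (¬ (minor2 A i j k l ≈ 0#)))
  RankAtLeast A (suc (suc (suc zero))) = Level.Lift c (¬ (det A ≈ 0#))

  HasRank : Mat → Fin 4 → Set (c ⊔ ℓ)
  HasRank A zero = ¬ RankAtLeast A (suc zero)
  HasRank A (suc zero) = RankAtLeast A (suc zero) × ¬ RankAtLeast A (suc (suc zero))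
  HasRank A (suc (suc zero)) =
    RankAtLeast A (suc (suc zero)) × ¬ RankAtLeast A (suc (suc (suc zero)))
  HasRank A (suc (suc (suc zero))) = RankAtLeast A (suc (suc (suc zero)))

  NonZero : Mat → Set ℓ
  NonZero A = ¬ (A ≈ₘ 0ₘ)

  Code : Set (lsuc (c ⊔ ℓ))
  Code = Mat → Set (c ⊔ ℓ)

  _⊆_ : Code → Code → Set (c ⊔ ℓ)
  C ⊆ D = ∀ M → C M → D M

  record IsLinearSRDCode (C : Code) : Set (c ⊔ ℓ) where
    field
      resp      : ∀ {M N} → M ≈ₘ N → C M → C N
      symmetric : ∀ M → C M → Symmetric M
      has-zero  : C 0ₘ
      closed-+  : ∀ M N → C M → C N → C (M +ₘ N)
      closed-·  : ∀ a M → C M → C (a ·ₘ M)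

  -- minimum distance d: minimum rank of the nonzero elements is d
  -- (C has a nonzero element of rank d, and every nonzero element has rank ≥ d)
  MinDistance : Code → Fin 4 → Set (c ⊔ ℓ)
  MinDistance C d =
    (∃[ M ] (C M × NonZero M × HasRank M d))
    × (∀ M → C M → NonZero M → RankAtLeast M d)

  TwoDimensional : Code → Set (c ⊔ ℓ)
  TwoDimensional C = ∃[ A ] ∃[ B ]
    ( C A × C B
    × (∀ a b → ((a ·ₘ A) +ₘ (b ·ₘ B)) ≈ₘ 0ₘ → (a ≈ 0#) × (b ≈ 0#))
    × (∀ M → C M → ∃[ a ] ∃[ b ] (M ≈ₘ ((a ·ₘ A) +ₘ (b ·ₘ B)))))

  Complete : Code → Fin 4 → Set (lsuc (c ⊔ ℓ))
  Complete C d = ¬ (∃[ D ] ( IsLinearSRDCode D × C ⊆ D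
                            × (∃[ M ] (D M × ¬ C M)) × MinDistance D d))

{-# OPTIONS --safe #-}
module Submission where

-- Let A, B span C. Adjoining a symmetric N to C keeps the minimum distance 2 unless
-- a N + s A + t B has rank ≤ 1 for some a ≠ 0, that is, unless N + s A + t B has rank ≤ 1 for
-- some s, t ("N is covered"); and N ∉ C unless N is covered. So if C is complete, all q⁶
-- symmetric matrices are covered. But a symmetric matrix of rank ≤ 1 is determined by its
-- pivot row w (its row through the first nonzero diagonal entry): it is w wᵀ divided by the
-- first nonzero entry of w. So at most q² · q³ = q⁵ matrices are covered, fewer than q⁶.
-- Equality in F is decidable only classically; since the conclusion is a negation, a
-- decision procedure can be extracted from the finite enumeration under a double negation.

open import Defs
open import Level using (Level; _⊔_; lift; lower)
open import Data.Nat as ℕ using (ℕ; _≤_; _<_; _^_)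
import Data.Nat.Properties as ℕ
open import Data.Fin using (Fin; Fin′; zero; suc; inject; combine; funToFin; finToFun)
import Data.Fin.Properties as Fin
open import Data.Product using (Σ; _×_; _,_; ∃; ∃-syntax; proj₁; proj₂; uncurry)
open import Data.Vec.Functional using (Vector; head; tail)
open import Function using (_∘_)
open import Relation.Binary.Bundles using (Setoid; DecSetoid)
open import Relation.Binary.Definitions using (Decidable)
open import Relation.Binary.PropositionalEquality as ≡ using (_≡_; _≗_)
open import Relation.Nullary using (¬_; Dec; yes; no; contradiction)
open import Relation.Nullary.Decidable using (map′; ¬?; decidable-stable; ¬¬-excluded-middle)
open import Relation.Unary using (Pred)

pattern 0F = zero
pattern 1F = suc zero
pattern 2F = suc (suc zero)
pattern 3F = suc (suc (suc zero))
pattern 4F = suc (suc (suc (suc zero)))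
pattern 5F = suc (suc (suc (suc (suc zero))))

funToFin-cong : ∀ {m n} {f g : Fin m → Fin n} → f ≗ g → funToFin f ≡ funToFin g
funToFin-cong {ℕ.zero} _ = ≡.refl
funToFin-cong {ℕ.suc m} f≗g = ≡.cong₂ combine (f≗g zero) (funToFin-cong (f≗g ∘ suc))

module _ {a p} {A : Set a} {P : Pred A p} where
  open import Data.List using ([]; _∷_)
  open import Data.List.Relation.Unary.All using (All; []; _∷_)

  ¬¬-all : (∀ x → ¬ ¬ P x) → ∀ xs → ¬ ¬ All P xs
  ¬¬-all ¬¬P [] ¬all = ¬all []
  ¬¬-all ¬¬P (x ∷ xs) ¬all = ¬¬P x λ px → ¬¬-all ¬¬P xs λ pxs → ¬all (px ∷ pxs)

module FiniteSetoid {a ℓ} (S : Setoid a ℓ) where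
  open Setoid S renaming (Carrier to A)
  open import Data.List using (List; lookup; length; deduplicate; cartesianProduct)
  open import Data.List.Membership.Propositional.Properties using (∈-lookup)
  import Data.List.Relation.Unary.All as All
  import Data.List.Relation.Unary.Any as Any
  open import Data.List.Relation.Unary.Any.Properties using (lookup-index)
  open import Data.List.Relation.Unary.AllPairs using (_∷_)
  open import Data.List.Relation.Unary.Enumerates.Setoid S using (IsEnumeration)
  import Data.List.Relation.Unary.Enumerates.Setoid.Properties as Enumerates
  open import Data.List.Relation.Unary.Unique.Setoid S using (Unique)
  open import Data.List.Relation.Unary.Unique.DecSetoid.Properties using (deduplicate-!)
  open import Data.Vec.Functional.Relation.Binary.Equality.Setoid S using (_≋_; ≋-sym)

  lookup-injective : ∀ {xs} → Unique xs → ∀ {i j} → lookup xs i ≈ lookup xs j → i ≡ j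
  lookup-injective (_ ∷ _) {zero} {zero} _ = ≡.refl
  lookup-injective (x≉xs ∷ _) {zero} {suc j} x≈xⱼ =
    contradiction x≈xⱼ (All.lookup x≉xs (∈-lookup j))
  lookup-injective (x≉xs ∷ _) {suc i} {zero} xᵢ≈x =
    contradiction (sym xᵢ≈x) (All.lookup x≉xs (∈-lookup i))
  lookup-injective (_ ∷ xs!) {suc i} {suc j} xᵢ≈xⱼ = ≡.cong suc (lookup-injective xs! xᵢ≈xⱼ)

  ¬¬-decidable : ∀ {xs} → IsEnumeration xs → ¬ ¬ Decidable _≈_
  ¬¬-decidable {xs} xs-enum ¬dec =
    ¬¬-all {P = Dec ∘ uncurry _≈_} (λ _ → ¬¬-excluded-middle) (cartesianProduct xs xs) λ decs →
      ¬dec λ x y →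
        transport (All.lookupAny decs (Enumerates.cartesianProduct⁺ S S xs-enum xs-enum (x , y)))
    where
    transport : ∀ {x y a b} → Dec (a ≈ b) × (x ≈ a × y ≈ b) → Dec (x ≈ y)
    transport (a≟b , x≈a , y≈b) = map′ (λ a≈b → trans x≈a (trans a≈b (sym y≈b)))
                                       (λ x≈y → trans (sym x≈a) (trans x≈y y≈b)) a≟b

  module Enumeration (_≟_ : Decidable _≈_) {xs} (xs-enum : IsEnumeration xs) where
    private
      S? : DecSetoid a ℓ
      S? = record { isDecEquivalence = record { isEquivalence = isEquivalence ; _≟_ = _≟_ } }

      distinct : List A
      distinct = deduplicate _≟_ xs

      distinct-enum : IsEnumeration distinct
      distinct-enum = Enumerates.deduplicate⁺ S? xs-enum

    size : ℕ
    size = length distinct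

    element : Fin size → A
    element = lookup distinct

    index : A → Fin size
    index x = Any.index (distinct-enum x)

    element-index : ∀ x → element (index x) ≈ x
    element-index x = sym (lookup-index (distinct-enum x))

    element-injective : ∀ {i j} → element i ≈ element j → i ≡ j
    element-injective = lookup-injective (deduplicate-! S? xs)

    index-injective : ∀ {x y} → index x ≡ index y → x ≈ y
    index-injective {x} {y} eq =
      trans (sym (element-index x)) (trans (reflexive (≡.cong element eq)) (element-index y))

    1<size : ∀ {x y} → ¬ x ≈ y → 1 < size
    1<size {x} {y} x≉y = Fin.injective⇒≤ pair-injective
      where
      pair : Fin 2 → Fin size
      pair zero = index x
      pair (suc _) = index y
      pair-injective : ∀ {i j} → pair i ≡ pair j → i ≡ j
      pair-injective {zero} {zero} _ = ≡.refl
      pair-injective {zero} {suc zero} eq = contradiction (index-injective eq) x≉y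
      pair-injective {suc zero} {zero} eq = contradiction (sym (index-injective eq)) x≉y
      pair-injective {suc zero} {suc zero} _ = ≡.refl

    decode : ∀ {n} → Fin (size ^ n) → Vector A n
    decode i = element ∘ finToFun i

    encode : ∀ {n} → Vector A n → Fin (size ^ n)
    encode v = funToFin (index ∘ v)

    decode-encode : ∀ {n} (v : Vector A n) → decode (encode v) ≋ v
    decode-encode v k =
      trans (reflexive (≡.cong element (Fin.finToFun-funToFin (index ∘ v) k))) (element-index (v k))

    decode-injective : ∀ {n} {i j : Fin (size ^ n)} → decode {n} i ≋ decode j → i ≡ j
    decode-injective {n} {i} {j} eq = begin
      i                                   ≡⟨ Fin.funToFin-finToFin {n} i ⟨
      funToFin (finToFun {size} {n} i)    ≡⟨ funToFin-cong (element-injective ∘ eq) ⟩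
      funToFin (finToFun {size} {n} j)    ≡⟨ Fin.funToFin-finToFin {n} j ⟩
      j                                   ∎
      where open ≡.≡-Reasoning

    encode-injective : ∀ {n} {u v : Vector A n} → encode u ≡ encode v → u ≋ v
    encode-injective {u = u} {v} eq k =
      trans (sym (decode-encode u k)) (trans (reflexive (≡.cong (λ i → decode i k) eq)) (decode-encode v k))

    ^-injective⇒≤ : ∀ {m n} (f : Vector A m → Vector A n) →
                    (∀ {u v} → f u ≋ f v → u ≋ v) → size ^ m ≤ size ^ n
    ^-injective⇒≤ {m} f f-injective =
      Fin.injective⇒≤ {f = encode ∘ f ∘ decode {m}} (decode-injective ∘ f-injective ∘ encode-injective)

    any? : ∀ {n p} {P : Pred (Vector A n) p} →
           (∀ {u v} → u ≋ v → P u → P v) → (∀ v → Dec (P v)) → Dec (∃ P)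
    any? P-resp P? = map′ (λ (i , P[i]) → decode i , P[i])
                          (λ (v , Pv) → encode v , P-resp (≋-sym (decode-encode v)) Pv)
                          (Fin.any? (P? ∘ decode))

module FieldProperties {c ℓ} (F : Field c ℓ) where
  open Field F hiding (zero)
  open import Algebra.Solver.Ring.NaturalCoefficients.Default commutativeSemiring
  open import Relation.Binary.Reasoning.Setoid setoid

  inverse-cancelˡ : ∀ {x y z w} → x * y ≈ 1# → x * z ≈ w → z ≈ y * w
  inverse-cancelˡ {x} {y} {z} {w} xy≈1 xz≈w = begin
    z              ≈⟨ *-identityˡ z ⟨
    1# * z         ≈⟨ *-congʳ xy≈1 ⟨
    (x * y) * z    ≈⟨ solve 3 (λ x y z → (x :* y) :* z := y :* (x :* z)) refl x y z ⟩
    y * (x * z)    ≈⟨ *-congˡ xz≈w ⟩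
    y * w          ∎

  inverse-unique : ∀ {x y z} → x * y ≈ 1# → x * z ≈ 1# → y ≈ z
  inverse-unique xy≈1 xz≈1 = trans (inverse-cancelˡ xz≈1 xy≈1) (*-identityʳ _)

  ≈0⇒¬invertible : ∀ {x y} → x ≈ 0# → ¬ (x * y ≈ 1#)
  ≈0⇒¬invertible {x} {y} x≈0 xy≈1 = 0≉1 (begin
    0#       ≈⟨ zeroˡ y ⟨
    0# * y   ≈⟨ *-congʳ x≈0 ⟨
    x * y    ≈⟨ xy≈1 ⟩
    1#       ∎)

  zero-combination : ∀ x y → 0# * x + 0# * y ≈ 0#
  zero-combination x y = trans (+-cong (zeroˡ x) (zeroˡ y)) (+-identityˡ 0#)

  square≈0⇒≈0 : Decidable _≈_ → ∀ {x} → x * x ≈ 0# → x ≈ 0#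
  square≈0⇒≈0 _≟_ {x} xx≈0 = decidable-stable (x ≟ 0#) λ x≉0 →
    let (y , xy≈1) = inverse x x≉0 in
    x≉0 (trans (inverse-cancelˡ xy≈1 xx≈0) (zeroʳ y))

module PivotRows {c ℓ} (F : Field c ℓ) (_≟_ : Decidable (Field._≈_ F)) where
  open Field F hiding (zero)
  open FieldProperties F
  open import Algebra.Solver.Ring.NaturalCoefficients.Default commutativeSemiring
  open import Data.Vec.Functional.Relation.Binary.Equality.Setoid setoid using (_≋_)
  open import Relation.Binary.Reasoning.Setoid setoid

  leadingInverse : ∀ {n} → Vector Carrier n → Carrier
  leadingInverse {ℕ.zero} _ = 0#
  leadingInverse {ℕ.suc n} w with head w ≟ 0#
  ... | yes _ = leadingInverse (tail w)
  ... | no w₀≉0 = proj₁ (inverse (head w) w₀≉0)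

  leadingInverse-cong : ∀ {n} {v w : Vector Carrier n} →
                        v ≋ w → leadingInverse v ≈ leadingInverse w
  leadingInverse-cong {ℕ.zero} _ = refl
  leadingInverse-cong {ℕ.suc n} {v} {w} v≋w with head v ≟ 0# | head w ≟ 0#
  ... | yes _ | yes _ = leadingInverse-cong (v≋w ∘ suc)
  ... | yes v₀≈0 | no w₀≉0 = contradiction (trans (sym (v≋w zero)) v₀≈0) w₀≉0
  ... | no v₀≉0 | yes w₀≈0 = contradiction (trans (v≋w zero) w₀≈0) v₀≉0
  ... | no v₀≉0 | no w₀≉0 =
    inverse-unique (proj₂ (inverse _ v₀≉0)) (trans (*-congʳ (v≋w zero)) (proj₂ (inverse _ w₀≉0)))

  leadingInverse-at : ∀ {n} {w : Vector Carrier n} {u} (p : Fin n) →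
                      (∀ (k : Fin′ p) → w (inject k) ≈ 0#) → w p * u ≈ 1# → leadingInverse w ≈ u
  leadingInverse-at {w = w} zero _ w₀u≈1 with head w ≟ 0#
  ... | yes w₀≈0 = contradiction w₀u≈1 (≈0⇒¬invertible w₀≈0)
  ... | no w₀≉0 = inverse-unique (proj₂ (inverse _ w₀≉0)) w₀u≈1
  leadingInverse-at {w = w} (suc p) before wₚu≈1 with head w ≟ 0#
  ... | yes _ = leadingInverse-at p (before ∘ suc) wₚu≈1
  ... | no w₀≉0 = contradiction (before zero) w₀≉0

  fromPivotRow : ∀ {n} → Vector Carrier n → Fin n → Fin n → Carrier
  fromPivotRow w i j = leadingInverse w * (w i * w j)

  fromPivotRow-cong : ∀ {n} {v w : Vector Carrier n} →
                      v ≋ w → ∀ i j → fromPivotRow v i j ≈ fromPivotRow w i j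
  fromPivotRow-cong v≋w i j = *-cong (leadingInverse-cong v≋w) (*-cong (v≋w i) (v≋w j))

  fromPivotRow-zero : ∀ {n} (i j : Fin n) → fromPivotRow (λ _ → 0#) i j ≈ 0#
  fromPivotRow-zero i j = trans (*-congˡ (zeroˡ 0#)) (zeroʳ _)

  MinorsVanish : ∀ {n} → (Fin n → Fin n → Carrier) → Set ℓ
  MinorsVanish R = ∀ i j k l → R i k * R j l ≈ R i l * R j k

  MinorsVanish-scale : ∀ {n} {R : Fin n → Fin n → Carrier} b →
                       MinorsVanish R → MinorsVanish (λ i j → b * R i j)
  MinorsVanish-scale {R = R} b R-minors i j k l = begin
    (b * R i k) * (b * R j l)   ≈⟨ square-scale (R i k) (R j l) ⟩
    (b * b) * (R i k * R j l)   ≈⟨ *-congˡ (R-minors i j k l) ⟩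
    (b * b) * (R i l * R j k)   ≈⟨ square-scale (R i l) (R j k) ⟨
    (b * R i l) * (b * R j k)   ∎
    where
    square-scale : ∀ x y → (b * x) * (b * y) ≈ (b * b) * (x * y)
    square-scale = solve 3 (λ b x y → (b :* x) :* (b :* y) := (b :* b) :* (x :* y)) refl b

  module _ {n} {R : Fin n → Fin n → Carrier}
           (R-sym : ∀ i j → R i j ≈ R j i) (R-minors : MinorsVanish R) where

    row≈0 : ∀ {k} → R k k ≈ 0# → ∀ j → R k j ≈ 0#
    row≈0 {k} Rkk≈0 j = square≈0⇒≈0 _≟_ (begin
      R k j * R k j   ≈⟨ *-congˡ (R-sym k j) ⟩
      R k j * R j k   ≈⟨ R-minors k j k j ⟨
      R k k * R j j   ≈⟨ *-congʳ Rkk≈0 ⟩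
      0# * R j j      ≈⟨ zeroˡ _ ⟩
      0#              ∎)

    pivot-expansion : ∀ {p u} → R p p * u ≈ 1# → ∀ i j → R i j ≈ u * (R p i * R p j)
    pivot-expansion {p} Rppu≈1 i j = inverse-cancelˡ Rppu≈1 (begin
      R p p * R i j   ≈⟨ R-minors p i p j ⟩
      R p j * R i p   ≈⟨ *-congˡ (R-sym i p) ⟩
      R p j * R p i   ≈⟨ *-comm _ _ ⟩
      R p i * R p j   ∎)

    minorsVanish⇒fromPivotRow : ∃[ w ] (∀ i j → R i j ≈ fromPivotRow w i j)
    minorsVanish⇒fromPivotRow with Fin.all? (λ p → R p p ≟ 0#)
    ... | yes diagonal≈0 =
      (λ _ → 0#) , λ i j → trans (row≈0 (diagonal≈0 i) j) (sym (fromPivotRow-zero i j))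
    ... | no ¬diagonal≈0 with Fin.¬∀⟶∃¬-smallest n _ (λ p → R p p ≟ 0#) ¬diagonal≈0
    ...   | p , Rpp≉0 , before with inverse (R p p) Rpp≉0
    ...     | u , Rppu≈1 = R p , λ i j → begin
      R i j                    ≈⟨ pivot-expansion Rppu≈1 i j ⟩
      u * (R p i * R p j)      ≈⟨ *-congʳ (leadingInverse-at p earlier-entries≈0 Rppu≈1) ⟨
      fromPivotRow (R p) i j   ∎
      where
      earlier-entries≈0 : ∀ k → R p (inject k) ≈ 0#
      earlier-entries≈0 k = trans (R-sym p _) (row≈0 (before k) p)

module SymmetricCodes {c ℓ} (F : Field c ℓ) where
  open Field F hiding (zero)
  open Matrices F
  open FieldProperties F using (zero-combination)
  open import Algebra.Solver.Ring.NaturalCoefficients.Default commutativeSemiring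
  open import Data.Vec.Functional.Relation.Binary.Equality.Setoid setoid using (_≋_)

  combination : Carrier → Mat → Carrier → Mat → Carrier → Mat → Mat
  combination a N s A t B = (a ·ₘ N) +ₘ ((s ·ₘ A) +ₘ (t ·ₘ B))

  Span : Mat → Mat → Mat → Code
  Span N A B M = ∃[ a ] ∃[ s ] ∃[ t ] (M ≈ₘ combination a N s A t B)

  module _ {N A B : Mat} where
    combination-symmetric : Symmetric N → Symmetric A → Symmetric B →
                            ∀ a s t → Symmetric (combination a N s A t B)
    combination-symmetric N-sym A-sym B-sym a s t i j =
      +-cong (*-congˡ (N-sym i j)) (+-cong (*-congˡ (A-sym i j)) (*-congˡ (B-sym i j)))

    combination-0 : combination 0# N 0# A 0# B ≈ₘ 0ₘ
    combination-0 i j = trans (+-cong (zeroˡ _) (zero-combination _ _)) (+-identityˡ 0#)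

    combination-+ : ∀ a s t a′ s′ t′ → (combination a N s A t B +ₘ combination a′ N s′ A t′ B)
                                       ≈ₘ combination (a + a′) N (s + s′) A (t + t′) B
    combination-+ a s t a′ s′ t′ i j =
      solve 9 (λ a s t a′ s′ t′ n x y →
                 (a :* n :+ (s :* x :+ t :* y)) :+ (a′ :* n :+ (s′ :* x :+ t′ :* y))
              := (a :+ a′) :* n :+ ((s :+ s′) :* x :+ (t :+ t′) :* y))
              refl a s t a′ s′ t′ (N i j) (A i j) (B i j)

    combination-· : ∀ k a s t → (k ·ₘ combination a N s A t B)
                                 ≈ₘ combination (k * a) N (k * s) A (k * t) B
    combination-· k a s t i j =
      solve 7 (λ k a s t n x y →
                 k :* (a :* n :+ (s :* x :+ t :* y))
              := (k :* a) :* n :+ ((k :* s) :* x :+ (k :* t) :* y))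
              refl k a s t (N i j) (A i j) (B i j)

    span-isLinearSRDCode : Symmetric N → Symmetric A → Symmetric B → IsLinearSRDCode (Span N A B)
    span-isLinearSRDCode N-sym A-sym B-sym = record
      { resp      = λ { M≈M′ (a , s , t , M≈) →
                        a , s , t , λ i j → trans (sym (M≈M′ i j)) (M≈ i j) }
      ; symmetric = λ { M (a , s , t , M≈) i j →
                        trans (M≈ i j) (trans (combination-symmetric N-sym A-sym B-sym a s t i j)
                                              (sym (M≈ j i))) }
      ; has-zero  = 0# , 0# , 0# , λ i j → sym (combination-0 i j)
      ; closed-+  = λ { M M′ (a , s , t , M≈) (a′ , s′ , t′ , M′≈) →
                        a + a′ , s + s′ , t + t′ ,
                        λ i j → trans (+-cong (M≈ i j) (M′≈ i j)) (combination-+ a s t a′ s′ t′ i j) }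
      ; closed-·  = λ { k M (a , s , t , M≈) → k * a , k * s , k * t ,
                        λ i j → trans (*-congˡ (M≈ i j)) (combination-· k a s t i j) }
      }

  symmetricMatrix : Vector Carrier 6 → Mat
  symmetricMatrix u 0F 0F = u 0F
  symmetricMatrix u 0F 1F = u 1F
  symmetricMatrix u 0F 2F = u 2F
  symmetricMatrix u 1F 0F = u 1F
  symmetricMatrix u 1F 1F = u 3F
  symmetricMatrix u 1F 2F = u 4F
  symmetricMatrix u 2F 0F = u 2F
  symmetricMatrix u 2F 1F = u 4F
  symmetricMatrix u 2F 2F = u 5F

  symmetricMatrix-symmetric : ∀ u → Symmetric (symmetricMatrix u)
  symmetricMatrix-symmetric u 0F 0F = refl
  symmetricMatrix-symmetric u 0F 1F = refl
  symmetricMatrix-symmetric u 0F 2F = refl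
  symmetricMatrix-symmetric u 1F 0F = refl
  symmetricMatrix-symmetric u 1F 1F = refl
  symmetricMatrix-symmetric u 1F 2F = refl
  symmetricMatrix-symmetric u 2F 0F = refl
  symmetricMatrix-symmetric u 2F 1F = refl
  symmetricMatrix-symmetric u 2F 2F = refl

  symmetricMatrix-injective : ∀ {u v} → symmetricMatrix u ≈ₘ symmetricMatrix v → u ≋ v
  symmetricMatrix-injective eq 0F = eq 0F 0F
  symmetricMatrix-injective eq 1F = eq 0F 1F
  symmetricMatrix-injective eq 2F = eq 0F 2F
  symmetricMatrix-injective eq 3F = eq 1F 1F
  symmetricMatrix-injective eq 4F = eq 1F 2F
  symmetricMatrix-injective eq 5F = eq 2F 2F

module Covering {c ℓ} (F : Field c ℓ) (_≟_ : Decidable (Field._≈_ F)) (finite : IsFinite F) where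
  open Field F hiding (zero)
  open Matrices F
  open FieldProperties F
  open PivotRows F _≟_
  open SymmetricCodes F
  open FiniteSetoid.Enumeration setoid _≟_ (proj₂ finite) using (any?)
  open import Algebra.Properties.Group +-group using (x∙y⁻¹≈ε⇒x≈y; ∙-cancelʳ)
  open import Algebra.Solver.Ring.NaturalCoefficients.Default commutativeSemiring
  open import Data.Vec.Functional using (_∷_)
  open import Data.Vec.Functional.Relation.Binary.Equality.Setoid setoid using (_≋_)
  open import Relation.Binary.Reasoning.Setoid setoid

  rank≥2? : ∀ M → Dec (RankAtLeast M 2F)
  rank≥2? M = map′ lift lower
    (Fin.any? λ i → Fin.any? λ j → Fin.any? λ k → Fin.any? λ l → ¬? (minor2 M i j k l ≟ 0#))

  ¬rank≥2⇒minorsVanish : ∀ {M} → ¬ RankAtLeast M 2F → MinorsVanish M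
  ¬rank≥2⇒minorsVanish {M} ¬rank≥2 i j k l = x∙y⁻¹≈ε⇒x≈y _ _
    (decidable-stable (minor2 M i j k l ≟ 0#) λ minor≉0 →
       ¬rank≥2 (lift (i , j , k , l , minor≉0)))

  module Extension {C : Code} (C-code : IsLinearSRDCode C) {A B : Mat} (A∈C : C A) (B∈C : C B)
                   (spanned : ∀ M → C M → ∃[ s ] ∃[ t ] (M ≈ₘ ((s ·ₘ A) +ₘ (t ·ₘ B))))
                   (minDistance : MinDistance C 2F) where
    open IsLinearSRDCode C-code

    -- p packs (s , t , w) into one vector: N + s A + t B is the rank-≤1 matrix with pivot row w.
    _CoveredBy_ : Mat → Vector Carrier 5 → Set ℓ
    N CoveredBy p = (N +ₘ ((p 0F ·ₘ A) +ₘ (p 1F ·ₘ B))) ≈ₘ fromPivotRow (tail (tail p))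

    Covered : Mat → Set (c ⊔ ℓ)
    Covered N = ∃ (N CoveredBy_)

    offset-cong : ∀ {p q : Vector Carrier 5} → p ≋ q →
                  ∀ i j → p 0F * A i j + p 1F * B i j ≈ q 0F * A i j + q 1F * B i j
    offset-cong p≋q i j = +-cong (*-congʳ (p≋q 0F)) (*-congʳ (p≋q 1F))

    CoveredBy-resp : ∀ {N p q} → p ≋ q → N CoveredBy p → N CoveredBy q
    CoveredBy-resp p≋q N-covered i j =
      trans (+-congˡ (sym (offset-cong p≋q i j)))
            (trans (N-covered i j) (fromPivotRow-cong (p≋q ∘ suc ∘ suc) i j))

    CoveredBy-injective : ∀ {M N p q} → M CoveredBy p → N CoveredBy q → p ≋ q → M ≈ₘ N
    CoveredBy-injective {M} {N} {p} {q} M-covered N-covered p≋q i j = ∙-cancelʳ _ _ _ (begin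
      M i j + (p 0F * A i j + p 1F * B i j)   ≈⟨ M-covered i j ⟩
      fromPivotRow (tail (tail p)) i j        ≈⟨ fromPivotRow-cong (p≋q ∘ suc ∘ suc) i j ⟩
      fromPivotRow (tail (tail q)) i j        ≈⟨ N-covered i j ⟨
      N i j + (q 0F * A i j + q 1F * B i j)   ≈⟨ +-congˡ (offset-cong p≋q i j) ⟨
      N i j + (p 0F * A i j + p 1F * B i j)   ∎)

    covered? : ∀ N → Dec (Covered N)
    covered? N = any? CoveredBy-resp λ p → Fin.all? λ i → Fin.all? λ j → _ ≟ _

    covers-by-scaling : ∀ {N a s t b M} → b * a ≈ 1# → M ≈ₘ combination a N s A t B →
                        ∀ i j → N i j + ((b * s) * A i j + (b * t) * B i j) ≈ b * M i j
    covers-by-scaling {N} {a} {s} {t} {b} {M} ba≈1 M≈ i j = begin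
      N i j + ((b * s) * A i j + (b * t) * B i j)              ≈⟨ +-congʳ (*-identityˡ _) ⟨
      1# * N i j + ((b * s) * A i j + (b * t) * B i j)         ≈⟨ +-congʳ (*-congʳ ba≈1) ⟨
      (b * a) * N i j + ((b * s) * A i j + (b * t) * B i j)    ≈⟨ combination-· {N} {A} {B} b a s t i j ⟨
      b * combination a N s A t B i j                          ≈⟨ *-congˡ (M≈ i j) ⟨
      b * M i j                                                ∎

    module _ {N : Mat} (N-sym : Symmetric N) (N-uncovered : ¬ Covered N) where
      span-code : IsLinearSRDCode (Span N A B)
      span-code = span-isLinearSRDCode N-sym (symmetric A A∈C) (symmetric B B∈C)

      C⊆span : C ⊆ Span N A B
      C⊆span M M∈C with spanned M M∈C
      ... | s , t , M≈ = 0# , s , t , λ i j → begin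
        M i j                                  ≈⟨ M≈ i j ⟩
        s * A i j + t * B i j                  ≈⟨ +-identityˡ _ ⟨
        0# + (s * A i j + t * B i j)           ≈⟨ +-congʳ (zeroˡ (N i j)) ⟨
        0# * N i j + (s * A i j + t * B i j)   ∎

      N∈span : Span N A B N
      N∈span = 1# , 0# , 0# , λ i j → begin
        N i j                                   ≈⟨ +-identityʳ _ ⟨
        N i j + 0#                              ≈⟨ +-cong (*-identityˡ _) (zero-combination _ _) ⟨
        1# * N i j + (0# * A i j + 0# * B i j)  ∎

      N∉C : ¬ C N
      N∉C N∈C with spanned N N∈C
      ... | s , t , N≈ = N-uncovered ((- s) ∷ (- t) ∷ (λ _ → 0#) , λ i j → begin
        N i j + ((- s) * A i j + (- t) * B i j)                     ≈⟨ +-congʳ (N≈ i j) ⟩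
        (s * A i j + t * B i j) + ((- s) * A i j + (- t) * B i j)   ≈⟨ collect s t (- s) (- t) _ _ ⟩
        (s - s) * A i j + (t - t) * B i j
          ≈⟨ +-cong (*-congʳ (-‿inverseʳ s)) (*-congʳ (-‿inverseʳ t)) ⟩
        0# * A i j + 0# * B i j                                     ≈⟨ zero-combination _ _ ⟩
        0#                                                          ≈⟨ fromPivotRow-zero i j ⟨
        fromPivotRow (λ _ → 0#) i j                                 ∎)
        where
        collect : ∀ s t s′ t′ x y → (s * x + t * y) + (s′ * x + t′ * y) ≈ (s + s′) * x + (t + t′) * y
        collect = solve 6 (λ s t s′ t′ x y → (s :* x :+ t :* y) :+ (s′ :* x :+ t′ :* y)
                                          := (s :+ s′) :* x :+ (t :+ t′) :* y) refl

      rank≤1⇒covered : ∀ {a s t M} → ¬ a ≈ 0# →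
                       M ≈ₘ combination a N s A t B → MinorsVanish M → Covered N
      rank≤1⇒covered {a} {s} {t} {M} a≉0 M≈ M-minors with inverse a a≉0
      ... | b , ab≈1 = (b * s) ∷ (b * t) ∷ proj₁ bM-normal , λ i j →
        trans (covers-by-scaling (trans (*-comm b a) ab≈1) M≈ i j) (proj₂ bM-normal i j)
        where
        bM-sym : Symmetric (b ·ₘ M)
        bM-sym i j = *-congˡ (IsLinearSRDCode.symmetric span-code M (a , s , t , M≈) i j)
        bM-normal : ∃[ w ] (∀ i j → b * M i j ≈ fromPivotRow w i j)
        bM-normal = minorsVanish⇒fromPivotRow bM-sym (MinorsVanish-scale b M-minors)

      span-rank≥2 : ∀ M → Span N A B M → NonZero M → RankAtLeast M 2F
      span-rank≥2 M (a , s , t , M≈) M≢0 with a ≟ 0#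
      ... | yes a≈0 = proj₂ minDistance M (resp (λ i j → sym (M≈offset i j)) M∈C) M≢0
        where
        M∈C : C ((s ·ₘ A) +ₘ (t ·ₘ B))
        M∈C = closed-+ _ _ (closed-· s A A∈C) (closed-· t B B∈C)
        M≈offset : M ≈ₘ ((s ·ₘ A) +ₘ (t ·ₘ B))
        M≈offset i j = trans (M≈ i j) (trans (+-congʳ (trans (*-congʳ a≈0) (zeroˡ _))) (+-identityˡ _))
      ... | no a≉0 = decidable-stable (rank≥2? M) λ ¬rank≥2 →
        N-uncovered (rank≤1⇒covered a≉0 M≈ (¬rank≥2⇒minorsVanish ¬rank≥2))

      uncovered⇒extension : ∃[ D ] ( IsLinearSRDCode D × C ⊆ D
                                    × (∃[ M ] (D M × ¬ C M)) × MinDistance D 2F)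
      uncovered⇒extension =
        let (M , M∈C , M≢0 , M-rank) = proj₁ minDistance in
        Span N A B , span-code , C⊆span , (N , N∈span , N∉C) ,
        (M , C⊆span M M∈C , M≢0 , M-rank) , span-rank≥2

    complete⇒covered : Complete C 2F → ∀ N → Symmetric N → Covered N
    complete⇒covered complete N N-sym =
      decidable-stable (covered? N) (complete ∘ uncovered⇒extension N-sym)

    covered⇒injection : (∀ N → Symmetric N → Covered N) →
                        Σ (Vector Carrier 6 → Vector Carrier 5) λ f → ∀ {u v} → f u ≋ f v → u ≋ v
    covered⇒injection cover = proj₁ ∘ covers , λ {u} {v} fu≋fv →
      symmetricMatrix-injective (CoveredBy-injective (proj₂ (covers u)) (proj₂ (covers v)) fu≋fv)
      where
      covers : ∀ u → Covered (symmetricMatrix u)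
      covers u = cover (symmetricMatrix u) (symmetricMatrix-symmetric u)

corollary3p15 : ∀ {c ℓ : Level} (F : Field c ℓ) → IsFinite F →
    let open Matrices F in
    (C : Code) → IsLinearSRDCode C → TwoDimensional C →
    MinDistance C (suc (suc zero)) → ¬ Complete C (suc (suc zero))
corollary3p15 F finite C C-code (A , B , A∈C , B∈C , _ , spanned) minDistance complete =
  FiniteSetoid.¬¬-decidable setoid (proj₂ finite) λ _≟_ →
    let open FiniteSetoid.Enumeration setoid _≟_ (proj₂ finite)
        open Covering.Extension F _≟_ finite C-code A∈C B∈C spanned minDistance
        (f , f-injective) = covered⇒injection (complete⇒covered complete)
    in ℕ.<⇒≱ (ℕ.^-monoʳ-< size (1<size 0≉1) (ℕ.n<1+n 5)) (^-injective⇒≤ f f-injective)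
  where open Field F using (setoid; 0≉1)
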